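{- Let $BG(V,E)$ be a bi-directed graph and let $BG^t(V^t,E^t)$ be the directed graph obtained from it by ListRankingTransform. Two distinct nodes $u,v\in V$ are connected by a bi-directed walk in $BG$ if and only if there exist signs $a,b\in\{+,-\}$ such that $u^a\in V^t$ is connected to $v^b\in V^t$ by a directed path in $BG^t$.
   Context: A bi-directed graph $BG(V,E)$ has edges $e=(v_i,v_j,o_1,o_2)$ with $v_i,v_j\in V$ and $o_1,o_2\in\{\rhd,\lhd\}$, the arrowhead orientations at $v_i$ and $v_j$ respectively; such an edge may be traversed from $v_i$ to $v_j$ or from $v_j$ to $v_i$. A bi-directed walk between $v_i$ and $v_j$ is a sequence $v_i,e_1,w_1,e_2,w_2,\ldots,w_m,e_{m+1},v_j$ of vertices and edges, each edge joining the consecutive vertices, such that at every intermediate vertex $w_l$ the arrowhead of the incoming edge $e_l$ at $w_l$ differs from the arrowhead of the outgoing edge $e_{l+1}$ at $w_l$. ListRankingTransform: $V^t$ contains two nodes $w^+,w^-$ for each $w\in V$ (identify $+$ with $\rhd$ and $-$ with $\lhd$, and write $\bar o$ for the orientation opposite to $o$); for each bi-directed edge $(x,y,o_1,o_2)\in E$, $E^t$ contains the directed edges $x^{o_1}\to y^{\bar{o_2}}$ and $y^{o_2}\to x^{\bar{o_1}}$ (so $w^{o}$ represents being at $w$ and leaving it through an edge whose arrowhead at $w$ is $o$). -}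

module Defs where

open import Data.Nat using (ℕ)
open import Data.Fin using (Fin)
open import Data.Product using (Σ; ∃; _×_; _,_)
open import Data.Sum using (_⊎_)
open import Data.List using (List; []; _∷_; _++_; concatMap)
open import Data.List.Membership.Propositional using (_∈_)
open import Data.List.Relation.Unary.Unique.Propositional using (Unique)
open import Relation.Binary.PropositionalEquality using (_≡_; _≢_)

-- Arrowhead orientations: ▷ is identified with + and ◁ with −.
data Ori : Set where
  ▷ ◁ : Ori

flip : Ori → Ori
flip ▷ = ◁
flip ◁ = ▷

record BEdge (n : ℕ) : Set where
  constructor bedge
  field
    vi : Fin n
    vj : Fin n
    o₁ : Ori
    o₂ : Ori

BiGraph : ℕ → Set
BiGraph n = List (BEdge n)

data Traverses {n : ℕ} : BEdge n → Fin n → Ori → Fin n → Ori → Set where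
  forward  : ∀ {x y ox oy} → Traverses (bedge x y ox oy) x ox y oy
  backward : ∀ {x y ox oy} → Traverses (bedge y x oy ox) x ox y oy

-- At every intermediate vertex the
-- arrowhead of the incoming edge differs from that of the outgoing edge.
data WalkFrom {n : ℕ} (E : BiGraph n) : Fin n → Ori → Fin n → Set where
  last : ∀ {x ox y oy} (e : BEdge n) → e ∈ E → Traverses e x ox y oy →
         WalkFrom E x ox y
  cons : ∀ {x ox w ow ow' y} (e : BEdge n) → e ∈ E → Traverses e x ox w ow →
         ow ≢ ow' → WalkFrom E w ow' y → WalkFrom E x ox y

BiWalk : {n : ℕ} → BiGraph n → Fin n → Fin n → Set
BiWalk E u v = Σ Ori (λ o → WalkFrom E u o v)

-- ListRankingTransform.  Vertex (w , o) stands for w^o.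
TVertex : ℕ → Set
TVertex n = Fin n × Ori

transformEdge : {n : ℕ} → BEdge n → List (TVertex n × TVertex n)
transformEdge (bedge x y o₁ o₂) =
  ((x , o₁) , (y , flip o₂)) ∷ ((y , o₂) , (x , flip o₁)) ∷ []

ListRankingTransform : {n : ℕ} → BiGraph n → List (TVertex n × TVertex n)
ListRankingTransform E = concatMap transformEdge E

data DWalk {A : Set} (D : List (A × A)) : A → A → List A → Set where
  here : ∀ {a} → DWalk D a a (a ∷ [])
  step : ∀ {a b c vs} → (a , b) ∈ D → DWalk D b c vs → DWalk D a c (a ∷ vs)

DPath : {A : Set} → List (A × A) → A → A → Set
DPath D s t = ∃ λ vs → DWalk D s t vs × Unique vs

-- A bi-directed walk from u, leaving each vertex w through an edge with
-- arrowhead o at w, is exactly a directed walk through the nodes w^o of the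
-- transform: traversing an edge from x (arrowhead ox) to y (arrowhead oy)
-- is the transformed arc x^ox → y^(flip oy), and the alternation condition
-- at y says that the next edge leaves y with arrowhead flip oy.  A directed
-- walk between distinct endpoints has at least one arc, and erasing its
-- loops leaves a directed path with the same endpoints.
module Submission where

open import Defs
open import Data.Nat using (ℕ)
open import Data.Fin using (Fin)
import Data.Fin as Fin
open import Data.Product using (Σ; ∃; ∃₂; _×_; _,_)
open import Data.Product.Properties using (≡-dec)
open import Data.List using (List; []; _∷_)
open import Data.List.Relation.Unary.Any using (here; there)
open import Data.List.Relation.Unary.All using ([])
open import Data.List.Relation.Unary.All.Properties using (¬Any⇒All¬)
open import Data.List.Relation.Unary.AllPairs using ([]; _∷_)
open import Data.List.Membership.Propositional using (_∈_; find; lose)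
open import Data.List.Membership.Propositional.Properties using (∈-concatMap⁺; ∈-concatMap⁻)
import Data.List.Membership.DecPropositional as DecMembership
open import Data.List.Relation.Unary.Unique.Propositional using (Unique)
open import Data.Empty using (⊥-elim)
open import Function.Bundles using (_⇔_; mk⇔)
open import Relation.Binary.Definitions using (DecidableEquality)
open import Relation.Binary.PropositionalEquality using (_≡_; refl; _≢_)
open import Relation.Nullary using (yes; no)

module _ {A : Set} (_≟_ : DecidableEquality A) {D : List (A × A)} where
  open DecMembership _≟_ using (_∈?_)

  DPath-fromMember : ∀ {s t u vs} → DWalk D s t vs → Unique vs → u ∈ vs → DPath D u t
  DPath-fromMember here       uniq       (here refl) = _ , here , uniq
  DPath-fromMember (step a w) uniq       (here refl) = _ , step a w , uniq
  DPath-fromMember (step a w) (_ ∷ uniq) (there u∈) = DPath-fromMember w uniq u∈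

  DWalk⇒DPath : ∀ {s t vs} → DWalk D s t vs → DPath D s t
  DWalk⇒DPath here = _ , here , [] ∷ []
  DWalk⇒DPath {s} (step a w) with DWalk⇒DPath w
  ... | ws , w′ , uniq with s ∈? ws
  ...   | yes s∈ws = DPath-fromMember w′ uniq s∈ws
  ...   | no  s∉ws = s ∷ ws , step a w′ , ¬Any⇒All¬ ws s∉ws ∷ uniq

_≟ᴼ_ : DecidableEquality Ori
▷ ≟ᴼ ▷ = yes refl
▷ ≟ᴼ ◁ = no λ ()
◁ ≟ᴼ ▷ = no λ ()
◁ ≟ᴼ ◁ = yes refl

flip-involutive : ∀ o → flip (flip o) ≡ o
flip-involutive ▷ = refl
flip-involutive ◁ = refl

flip-≢ : ∀ o → flip o ≢ o
flip-≢ ▷ ()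
flip-≢ ◁ ()

≢⇒≡flip : ∀ {o o′} → o ≢ o′ → o′ ≡ flip o
≢⇒≡flip {▷} {▷} o≢o′ = ⊥-elim (o≢o′ refl)
≢⇒≡flip {▷} {◁} _    = refl
≢⇒≡flip {◁} {▷} _    = refl
≢⇒≡flip {◁} {◁} o≢o′ = ⊥-elim (o≢o′ refl)

Traverses⇒∈transformEdge : ∀ {n} {e : BEdge n} {x ox y oy} → Traverses e x ox y oy →
                           ((x , ox) , (y , flip oy)) ∈ transformEdge e
Traverses⇒∈transformEdge forward  = here refl
Traverses⇒∈transformEdge backward = there (here refl)

∈transformEdge⇒Traverses : ∀ {n} (e : BEdge n) {x ox y oy} → ((x , ox) , (y , oy)) ∈ transformEdge e →
                           Traverses e x ox y (flip oy)
∈transformEdge⇒Traverses (bedge _ _ _ o₂) (here refl)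
  rewrite flip-involutive o₂ = forward
∈transformEdge⇒Traverses (bedge _ _ o₁ _) (there (here refl))
  rewrite flip-involutive o₁ = backward

module _ {n : ℕ} (E : BiGraph n) where
  private
    T : List (TVertex n × TVertex n)
    T = ListRankingTransform E

  Traverses⇒∈transform : ∀ {e : BEdge n} {x ox y oy} → e ∈ E → Traverses e x ox y oy →
                         ((x , ox) , (y , flip oy)) ∈ T
  Traverses⇒∈transform e∈E t = ∈-concatMap⁺ transformEdge (lose e∈E (Traverses⇒∈transformEdge t))

  ∈transform⇒Traverses : ∀ {x ox y oy} → ((x , ox) , (y , oy)) ∈ T →
                         ∃ λ e → e ∈ E × Traverses e x ox y (flip oy)
  ∈transform⇒Traverses a with find (∈-concatMap⁻ transformEdge {xs = E} a)
  ... | e , e∈E , a∈e = e , e∈E , ∈transformEdge⇒Traverses e a∈e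

  WalkFrom⇒DWalk : ∀ {x o y} → WalkFrom E x o y → ∃₂ λ b vs → DWalk T (x , o) (y , b) vs
  WalkFrom⇒DWalk (last _ e∈E t) = _ , _ , step (Traverses⇒∈transform e∈E t) here
  WalkFrom⇒DWalk (cons _ e∈E t ow≢ow′ w) with WalkFrom⇒DWalk w
  ... | b , vs , dw rewrite ≢⇒≡flip ow≢ow′ = b , _ , step (Traverses⇒∈transform e∈E t) dw

  -- Stated for a walk behind a leading arc, because a bi-directed walk has at least one edge.
  DWalk⇒WalkFrom : ∀ {x o w ow y b vs} → ((x , o) , (w , ow)) ∈ T →
                   DWalk T (w , ow) (y , b) vs → WalkFrom E x o y
  DWalk⇒WalkFrom a here = let e , e∈E , t = ∈transform⇒Traverses a in last e e∈E t
  DWalk⇒WalkFrom a (step a′ dw) =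
    let e , e∈E , t = ∈transform⇒Traverses a in cons e e∈E t (flip-≢ _) (DWalk⇒WalkFrom a′ dw)

lemma1 : (n : ℕ) (E : BiGraph n) (u v : Fin n) → u ≢ v →
         BiWalk E u v ⇔ Σ Ori (λ a → Σ Ori (λ b → DPath (ListRankingTransform E) (u , a) (v , b)))
lemma1 n E u v u≢v = mk⇔ walk⇒path path⇒walk
  where
  walk⇒path : BiWalk E u v → Σ Ori (λ a → Σ Ori (λ b → DPath (ListRankingTransform E) (u , a) (v , b)))
  walk⇒path (a , w) with WalkFrom⇒DWalk E w
  ... | b , _ , dw = a , b , DWalk⇒DPath (≡-dec Fin._≟_ _≟ᴼ_) dw

  path⇒walk : Σ Ori (λ a → Σ Ori (λ b → DPath (ListRankingTransform E) (u , a) (v , b))) → BiWalk E u v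
  path⇒walk (_ , _ , _ , here , _)        = ⊥-elim (u≢v refl)
  path⇒walk (a , _ , _ , step arc dw , _) = a , DWalk⇒WalkFrom E arc dw
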